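{- Let $G_1,G_2,G_3$ be graphs on a set $X$ such that $G_1\approx G_3$ and $G_3$ is isomorphic to $G_2$. Then there is a graph $G_3'$ on $X$ such that $G_1$ is isomorphic to $G_3'$ and $G_3'\approx G_2$.
   Context: A graph on $X$ is $\langle X,\mathcal E\rangle$ with $\mathcal E$ a set of 2-element subsets of $X$. $G\approx H$ iff the symmetric difference of their edge sets equals the edge set of $K_{A,X\setminus A}$ (all $\{a,b\}$ with $a\in A$, $b\in X\setminus A$) for some $A\subseteq X$. -}

module Defs where

open import Data.Bool using (Bool; false; _xor_)
open import Data.Product using (∃)
open import Function.Bundles using (Bijection; _⤖_)
open import Relation.Binary.PropositionalEquality using (_≡_)

record Graph (X : Set) : Set where
  field
    adj    : X → X → Bool
    sym    : ∀ x y → adj x y ≡ adj y x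
    irrefl : ∀ x → adj x x ≡ false
open Graph public

Subset : Set → Set
Subset X = X → Bool

-- Edge indicator of the complete bipartite graph K_{A, X∖A}:
-- {x,y} is an edge iff exactly one of x, y lies in A.
cut : {X : Set} → Subset X → X → X → Bool
cut A x y = A x xor A y

_≈_ : {X : Set} → Graph X → Graph X → Set
_≈_ {X} G H = ∃ λ (A : Subset X) → ∀ x y → (adj G x y xor adj H x y) ≡ cut A x y

_≅_ : {X : Set} → Graph X → Graph X → Set
_≅_ {X} G H = ∃ λ (f : X ⤖ X) →
  ∀ x y → adj G x y ≡ adj H (Bijection.to f x) (Bijection.to f y)

-- Pull G₁ back along the inverse of the isomorphism f : G₃ ≅ G₂. Pulling back
-- along a bijection yields an isomorphic graph, and pulling back preserves ≈
-- (the cut by A becomes the cut by A ∘ f⁻¹); since G₃ pulled back along f⁻¹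
-- is G₂, the pulled-back G₁ is ≈ G₂.
module Submission where

open import Defs
open import Data.Bool using (_xor_)
open import Data.Product using (∃; _×_; _,_)
open import Function.Base using (_∘_)
open import Function.Bundles using (Inverse; _⤖_)
open import Function.Properties.Bijection using (⤖⇒↔)
open import Relation.Binary.PropositionalEquality
  using (_≡_; trans; cong; cong₂) renaming (sym to ≡-sym)

comap : {X Y : Set} → (X → Y) → Graph Y → Graph X
comap h G = record
  { adj    = λ x y → adj G (h x) (h y)
  ; sym    = λ x y → Graph.sym G (h x) (h y)
  ; irrefl = λ x → Graph.irrefl G (h x)
  }

comap-≈ : {X Y : Set} (h : X → Y) {G H : Graph Y} → G ≈ H → comap h G ≈ comap h H
comap-≈ h (A , G⊕H≡cutA) = A ∘ h , λ x y → G⊕H≡cutA (h x) (h y)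

≈-respʳ : {X : Set} {G H H′ : Graph X} →
  (∀ x y → adj H x y ≡ adj H′ x y) → G ≈ H → G ≈ H′
≈-respʳ {G = G} H≡H′ (A , G⊕H≡cutA) =
  A , λ x y → trans (cong (adj G x y xor_) (≡-sym (H≡H′ x y))) (G⊕H≡cutA x y)

≅-comap-inverse : {X : Set} (f : X ⤖ X) (G : Graph X) →
  G ≅ comap (Inverse.from (⤖⇒↔ f)) G
≅-comap-inverse f G = f , λ x y →
  ≡-sym (cong₂ (adj G) (Inverse.strictlyInverseʳ I x) (Inverse.strictlyInverseʳ I y))
  where I = ⤖⇒↔ f

≅⇒≡-comap-inverse : {X : Set} {G H : Graph X} ((f , _) : G ≅ H) →
  ∀ x y → adj (comap (Inverse.from (⤖⇒↔ f)) G) x y ≡ adj H x y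
≅⇒≡-comap-inverse {G = G} {H} (f , G≡H∘f) x y =
  trans (G≡H∘f (from x) (from y))
        (cong₂ (adj H) (Inverse.strictlyInverseˡ I x) (Inverse.strictlyInverseˡ I y))
  where
  I = ⤖⇒↔ f
  from = Inverse.from I

lemma1p4 : {X : Set} (G₁ G₂ G₃ : Graph X) → G₁ ≈ G₃ → G₃ ≅ G₂ →
    ∃ λ (G₃′ : Graph X) → (G₁ ≅ G₃′) × (G₃′ ≈ G₂)
lemma1p4 G₁ G₂ G₃ G₁≈G₃ G₃≅G₂@(f , _) =
    comap f⁻¹ G₁
  , ≅-comap-inverse f G₁
  , ≈-respʳ {G = comap f⁻¹ G₁} {comap f⁻¹ G₃} {G₂}
      (≅⇒≡-comap-inverse {G = G₃} {G₂} G₃≅G₂) (comap-≈ f⁻¹ {G₁} {G₃} G₁≈G₃)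
  where f⁻¹ = Inverse.from (⤖⇒↔ f)
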